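{- Let $n \ge 3$ be an integer and let $A \subseteq \{1, 2, \ldots, 2n\}$ be a set with $|A| \ge n+1$. Then there exist integers $0 \le b_1 < b_2 < b_3$ such that $b_1+b_2$, $b_1+b_3$ and $b_2+b_3$ all belong to $A$. -}

-- Induction on n, with n = 3 checked by enumerating the subsets of {1,…,6}.
-- For the step n → n + 1, if 2n + 1 or 2n + 2 is missing from A, then A has at
-- least n + 1 elements in {1,…,2n} and the induction hypothesis applies.
-- Otherwise both are in A. An odd 2k + 1 ∈ A below 2n + 1 gives the triple
-- (k, k + 1, 2n + 1 − k). If there is none, A lies inside the n + 2 numbers
-- 2, 4, …, 2n, 2n + 1, 2n + 2, hence is all of them, and (0, 2, 4) works.
module Submission where

open import Data.Empty using (⊥-elim)
open import Data.List using (List; []; _∷_; length; filter; map; _++_; applyUpTo; upTo)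
open import Data.List.Properties using (length-removeAt′; length-applyUpTo)
open import Data.List.Relation.Unary.All as All using (All)
open import Data.List.Relation.Unary.Any using (Any; here; there; any?; satisfied)
open import Data.List.Relation.Unary.Unique.Propositional using (Unique; []; _∷_)
open import Data.List.Relation.Unary.Unique.Propositional.Properties using (filter⁺)
open import Data.List.Relation.Binary.Subset.Propositional using (_⊆_)
open import Data.List.Membership.Propositional using (_∈_; _∉_; _─_; find; lose)
open import Data.List.Membership.Propositional.Properties
  using (∈-filter⁺; ∈-filter⁻; ∈-map⁺; ∈-++⁺ˡ; ∈-++⁺ʳ; ∈-applyUpTo⁺; ∈-upTo⁺; ∈-upTo⁻)
open import Data.Nat using (ℕ; zero; suc; _+_; _*_; _∸_; _≤_; _<_; z≤n; s≤s; _<?_; _≤?_; _≟_)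
open import Data.Nat.Properties
open import Data.Nat.Tactic.RingSolver using (solve-∀)
open import Data.Product using (_×_; ∃-syntax; _,_; proj₁; proj₂)
open import Data.Sum using (_⊎_; inj₁; inj₂; [_,_]′; map₂; swap)
open import Function using (id)
open import Level using (Level)
open import Relation.Binary.Definitions using (DecidableEquality)
open import Relation.Binary.PropositionalEquality using (_≡_; _≢_; refl; sym; trans; cong; subst)
open import Relation.Nullary using (yes; no; contradiction)
open import Relation.Nullary.Decidable using (_×-dec_; _→-dec_; toWitness)
open import Relation.Unary using (Pred; Decidable)

private
  variable
    a p : Level
    X : Set a

∈-─ : ∀ {x z} {ys : List X} (x∈ys : x ∈ ys) → z ∈ ys → z ≢ x → z ∈ ys ─ x∈ys
∈-─ (here refl)  (here refl)  z≢x = ⊥-elim (z≢x refl)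
∈-─ (here refl)  (there z∈ys) _   = z∈ys
∈-─ (there _)    (here refl)  _   = here refl
∈-─ (there x∈ys) (there z∈ys) z≢x = there (∈-─ x∈ys z∈ys z≢x)

unique-⊆⇒length-≤ : ∀ {xs ys : List X} → Unique xs → xs ⊆ ys → length xs ≤ length ys
unique-⊆⇒length-≤ [] _ = z≤n
unique-⊆⇒length-≤ {xs = x ∷ xs} {ys} (x∉xs ∷ u) x∷xs⊆ys = begin
  suc (length xs)          ≤⟨ s≤s (unique-⊆⇒length-≤ u xs⊆ys─x) ⟩
  suc (length (ys ─ x∈ys)) ≡⟨ length-removeAt′ ys _ ⟨
  length ys                ∎
  where
  open ≤-Reasoning
  x∈ys : x ∈ ys
  x∈ys = x∷xs⊆ys (here refl)
  xs⊆ys─x : xs ⊆ ys ─ x∈ys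
  xs⊆ys─x z∈xs = ∈-─ x∈ys (x∷xs⊆ys (there z∈xs)) (λ z≡x → All.lookup x∉xs z∈xs (sym z≡x))

unique-⊆-length-≥⇒⊇ : DecidableEquality X → ∀ {xs ys : List X} →
                      Unique xs → xs ⊆ ys → length ys ≤ length xs → ys ⊆ xs
unique-⊆-length-≥⇒⊇ _≟ₓ_ {xs} {ys} u xs⊆ys ys≤xs {y} y∈ys with any? (y ≟ₓ_) xs
... | yes y∈xs = y∈xs
... | no  y∉xs = contradiction ys≤xs (<⇒≱ (begin-strict
  length xs                ≤⟨ unique-⊆⇒length-≤ u xs⊆ys─y ⟩
  length (ys ─ y∈ys)       <⟨ ≤-reflexive (sym (length-removeAt′ ys _)) ⟩
  length ys                ∎))
  where
  open ≤-Reasoning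
  xs⊆ys─y : xs ⊆ ys ─ y∈ys
  xs⊆ys─y z∈xs = ∈-─ y∈ys (xs⊆ys z∈xs) (λ { refl → y∉xs z∈xs })

length-≤-suc-filter : ∀ {P : Pred X p} (P? : Decidable P) {o} {xs : List X} → Unique xs →
                      (∀ {z} → z ∈ xs → P z ⊎ z ≡ o) → length xs ≤ suc (length (filter P? xs))
length-≤-suc-filter P? u cover = unique-⊆⇒length-≤ u λ z∈xs →
  [ (λ Pz → there (∈-filter⁺ P? z∈xs Pz)) , here ]′ (cover z∈xs)

sublists : List X → List (List X)
sublists []       = [] ∷ []
sublists (x ∷ xs) = map (x ∷_) (sublists xs) ++ sublists xs

filter∈sublists : ∀ {P : Pred X p} (P? : Decidable P) xs → filter P? xs ∈ sublists xs
filter∈sublists P? []       = here refl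
filter∈sublists P? (x ∷ xs) with P? x
... | yes _ = ∈-++⁺ˡ (∈-map⁺ (x ∷_) (filter∈sublists P? xs))
... | no  _ = ∈-++⁺ʳ (map (x ∷_) (sublists xs)) (filter∈sublists P? xs)

∈-applyUpTo-suc⁺ : ∀ {x n} → 1 ≤ x → x ≤ n → x ∈ applyUpTo suc n
∈-applyUpTo-suc⁺ {suc x} _ x<n = ∈-applyUpTo⁺ suc x<n

≤2+n-cases : ∀ {z n} → z ≤ 2 + n → z ≤ n ⊎ z ≡ 1 + n ⊎ z ≡ 2 + n
≤2+n-cases z≤2+n with m≤n⇒m<n∨m≡n z≤2+n
... | inj₂ z≡2+n = inj₂ (inj₂ z≡2+n)
... | inj₁ z<2+n with m≤n⇒m<n∨m≡n (≤-pred z<2+n)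
...   | inj₂ z≡1+n = inj₂ (inj₁ z≡1+n)
...   | inj₁ z<1+n = inj₁ (≤-pred z<1+n)

even-or-odd : ∀ x → ∃[ q ] (x ≡ 2 * q ⊎ x ≡ suc (2 * q))
even-or-odd zero = 0 , inj₁ refl
even-or-odd (suc x) with even-or-odd x
... | q , inj₁ refl = q , inj₂ refl
... | q , inj₂ refl = suc q , inj₁ (sym (*-suc 2 q))

SumTriple : List ℕ → ℕ → ℕ → ℕ → Set
SumTriple A b₁ b₂ b₃ = b₁ < b₂ × b₂ < b₃ × (b₁ + b₂) ∈ A × (b₁ + b₃) ∈ A × (b₂ + b₃) ∈ A

HasSumTriple : List ℕ → Set
HasSumTriple A = ∃[ b₁ ] ∃[ b₂ ] ∃[ b₃ ] SumTriple A b₁ b₂ b₃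

HasSumTriple-mono : ∀ {A B} → A ⊆ B → HasSumTriple A → HasSumTriple B
HasSumTriple-mono A⊆B (b₁ , b₂ , b₃ , b₁<b₂ , b₂<b₃ , s₁₂ , s₁₃ , s₂₃) =
  b₁ , b₂ , b₃ , b₁<b₂ , b₂<b₃ , A⊆B s₁₂ , A⊆B s₁₃ , A⊆B s₂₃

two-four-six-triple : ∀ {A} → 2 ∈ A → 4 ∈ A → 6 ∈ A → HasSumTriple A
two-four-six-triple 2∈A 4∈A 6∈A = 0 , 2 , 4 , s≤s z≤n , s≤s (s≤s (s≤s z≤n)) , 2∈A , 4∈A , 6∈A

-- The triple is (k, k + 1, 2l + 1 − k), with l = k + 1 + d to avoid subtraction.
odd-sums-triple : ∀ {A k l} → k < l →
                  suc (2 * k) ∈ A → suc (2 * l) ∈ A → suc (suc (2 * l)) ∈ A → HasSumTriple A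
odd-sums-triple {A} {k} k<l s₁₂ s₁₃ s₂₃ with d , refl ← m≤n⇒∃[o]m+o≡n k<l =
  k , suc k , suc k + suc (suc (2 * d)) , n<1+n k , m<m+n (suc k) (s≤s z≤n) ,
  subst (_∈ A) (sum₁₂ k) s₁₂ , subst (_∈ A) (sum₁₃ k d) s₁₃ , subst (_∈ A) (sum₂₃ k d) s₂₃
  where
  sum₁₂ : ∀ k → suc (2 * k) ≡ k + suc k
  sum₁₂ = solve-∀
  sum₁₃ : ∀ k d → suc (2 * (suc k + d)) ≡ k + (suc k + suc (suc (2 * d)))
  sum₁₃ = solve-∀
  sum₂₃ : ∀ k d → suc (suc (2 * (suc k + d))) ≡ suc k + (suc k + suc (suc (2 * d)))
  sum₂₃ = solve-∀

Claim : ℕ → Set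
Claim n = ∀ A → Unique A → All (λ a → 1 ≤ a × a ≤ 2 * n) A → n + 1 ≤ length A → HasSumTriple A

SmallSumTriple : List ℕ → Set
SmallSumTriple S = Any (λ b₁ → Any (λ b₂ → Any (SumTriple S b₁ b₂) (upTo 6)) (upTo 6)) (upTo 6)

small-sum-triple? : Decidable SmallSumTriple
small-sum-triple? S = any? (λ b₁ → any? (λ b₂ → any? (λ b₃ →
  (b₁ <? b₂) ×-dec (b₂ <? b₃) ×-dec
  any? ((b₁ + b₂) ≟_) S ×-dec any? ((b₁ + b₃) ≟_) S ×-dec any? ((b₂ + b₃) ≟_) S)
  (upTo 6)) (upTo 6)) (upTo 6)

SmallSumTriple⇒HasSumTriple : ∀ {S} → SmallSumTriple S → HasSumTriple S
SmallSumTriple⇒HasSumTriple t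
  with b₁ , t₁   ← satisfied t
  with b₂ , t₂   ← satisfied t₁
  with b₃ , sums ← satisfied t₂ = b₁ , b₂ , b₃ , sums

large-sublists-of-[1‥6]-have-sum-triples :
  All (λ S → 4 ≤ length S → SmallSumTriple S) (sublists (applyUpTo suc 6))
large-sublists-of-[1‥6]-have-sum-triples = toWitness {a? = All.all?
  (λ S → (4 ≤? length S) →-dec small-sum-triple? S) (sublists (applyUpTo suc 6))} _

claim₃ : Claim 3
claim₃ A u bounded large = HasSumTriple-mono S⊆A (SmallSumTriple⇒HasSumTriple
  (All.lookup large-sublists-of-[1‥6]-have-sum-triples (filter∈sublists A? (applyUpTo suc 6))
    (≤-trans large (unique-⊆⇒length-≤ u A⊆S))))
  where
  A? : Decidable (_∈ A)
  A? x = any? (x ≟_) A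
  S : List ℕ
  S = filter A? (applyUpTo suc 6)
  A⊆S : A ⊆ S
  A⊆S z∈A = let (1≤z , z≤6) = All.lookup bounded z∈A in ∈-filter⁺ A? (∈-applyUpTo-suc⁺ 1≤z z≤6) z∈A
  S⊆A : S ⊆ A
  S⊆A z∈S = proj₂ (∈-filter⁻ A? z∈S)

below-or-top : ∀ {m A} → All (λ a → 1 ≤ a × a ≤ 2 * suc m) A →
               ∀ {z} → z ∈ A → z ≤ 2 * m ⊎ z ≡ suc (2 * m) ⊎ z ≡ suc (suc (2 * m))
below-or-top {m} bounded {z} z∈A = ≤2+n-cases (subst (z ≤_) (*-suc 2 m) (proj₂ (All.lookup bounded z∈A)))

claim-missing-top : ∀ {m} → Claim m → ∀ A → Unique A → All (λ a → 1 ≤ a × a ≤ 2 * suc m) A →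
                    suc m + 1 ≤ length A → ∀ {t o} → t ∉ A →
                    (∀ {z} → z ∈ A → z ≤ 2 * m ⊎ z ≡ t ⊎ z ≡ o) → HasSumTriple A
claim-missing-top {m} ih A u bounded large {t} {o} t∉A cases =
  HasSumTriple-mono A′⊆A (ih A′ (filter⁺ low? u) bounded′ large′)
  where
  low? : Decidable (_≤ 2 * m)
  low? z = z ≤? 2 * m
  A′ : List ℕ
  A′ = filter low? A
  A′⊆A : A′ ⊆ A
  A′⊆A z∈A′ = proj₁ (∈-filter⁻ low? z∈A′)
  bounded′ : All (λ a → 1 ≤ a × a ≤ 2 * m) A′
  bounded′ = All.tabulate λ z∈A′ → let (z∈A , z≤2m) = ∈-filter⁻ low? z∈A′
                                   in proj₁ (All.lookup bounded z∈A) , z≤2m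
  low-or-o : ∀ {z} → z ∈ A → z ≤ 2 * m ⊎ z ≡ o
  low-or-o z∈A = map₂ [ (λ { refl → ⊥-elim (t∉A z∈A) }) , id ]′ (cases z∈A)
  large′ : m + 1 ≤ length A′
  large′ = ≤-pred (≤-trans large (length-≤-suc-filter low? u low-or-o))

evens : ℕ → List ℕ
evens m = applyUpTo (λ k → 2 * suc k) m

claim-no-small-odd : ∀ {m} → 3 ≤ m → ∀ A → Unique A → All (λ a → 1 ≤ a × a ≤ 2 * suc m) A →
                     suc m + 1 ≤ length A → (∀ {k} → k < m → suc (2 * k) ∉ A) → HasSumTriple A
claim-no-small-odd {m} 3≤m A u bounded large no-small-odd =
  two-four-six-triple (evens⊆A (≤-trans (s≤s z≤n) 3≤m))
                      (evens⊆A (≤-trans (s≤s (s≤s z≤n)) 3≤m)) (evens⊆A 3≤m)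
  where
  B : List ℕ
  B = suc (2 * m) ∷ suc (suc (2 * m)) ∷ evens m
  A⊆B : A ⊆ B
  A⊆B {z} z∈A with below-or-top bounded z∈A
  ... | inj₂ (inj₁ refl) = here refl
  ... | inj₂ (inj₂ refl) = there (here refl)
  ... | inj₁ z≤2m with even-or-odd z
  ...   | q , inj₂ refl     = ⊥-elim (no-small-odd (*-cancelˡ-< 2 q m z≤2m) z∈A)
  ...   | zero , inj₁ refl  = ⊥-elim (<⇒≱ (proj₁ (All.lookup bounded z∈A)) z≤n)
  ...   | suc q , inj₁ refl = there (there (∈-applyUpTo⁺ _ (*-cancelˡ-≤ 2 z≤2m)))
  B≤A : length B ≤ length A
  B≤A = subst (_≤ length A) (cong suc (trans (+-comm m 1) (cong suc (sym (length-applyUpTo _ m))))) large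
  evens⊆A : ∀ {k} → k < m → 2 * suc k ∈ A
  evens⊆A k<m = unique-⊆-length-≥⇒⊇ _≟_ u A⊆B B≤A (there (there (∈-applyUpTo⁺ _ k<m)))

claim-step : ∀ {m} → 3 ≤ m → Claim m → Claim (suc m)
claim-step {m} 3≤m ih A u bounded large
  with any? (suc (2 * m) ≟_) A | any? (suc (suc (2 * m)) ≟_) A
... | no 2m+1∉A | _ = claim-missing-top ih A u bounded large 2m+1∉A (below-or-top bounded)
... | yes _ | no 2m+2∉A =
  claim-missing-top ih A u bounded large 2m+2∉A (λ z∈A → map₂ swap (below-or-top bounded z∈A))
... | yes 2m+1∈A | yes 2m+2∈A with any? (λ k → any? (suc (2 * k) ≟_) A) (upTo m)
...   | yes small-odd = let k , k∈ , 2k+1∈A = find small-odd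
                        in odd-sums-triple (∈-upTo⁻ k∈) 2k+1∈A 2m+1∈A 2m+2∈A
...   | no no-small-odd =
  claim-no-small-odd 3≤m A u bounded large (λ k<m 2k+1∈A → no-small-odd (lose (∈-upTo⁺ k<m) 2k+1∈A))

claim : ∀ k → Claim (3 + k)
claim zero    = claim₃
claim (suc k) = claim-step (m≤m+n 3 k) (claim k)

theorem3 : (n : ℕ) → 3 ≤ n → (A : List ℕ) → Unique A
    → All (λ a → 1 ≤ a × a ≤ 2 * n) A → n + 1 ≤ length A
    → ∃[ b₁ ] ∃[ b₂ ] ∃[ b₃ ] (b₁ < b₂ × b₂ < b₃
    × (b₁ + b₂) ∈ A × (b₁ + b₃) ∈ A × (b₂ + b₃) ∈ A)
theorem3 n 3≤n = subst Claim (m+[n∸m]≡n 3≤n) (claim (n ∸ 3))
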